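{- Let $C$ be a clusteron occupying at least two rooms. Then some state reachable from $C$ is a flat clusteron or a flat near-clusteron.
   Context: Rooms are indexed by the integers, room $i$ adjacent to rooms $i\pm1$. A state is a function $a:\mathbb{Z}\to\mathbb{Z}_{\ge0}$ with finite support ($a_i$ = number of indistinguishable violinists in room $i$; several may share a room); room $i$ is occupied if $a_i\ge1$. A move is possible whenever two adjacent rooms $i,i+1$ are both occupied: one violinist leaves room $i$ for the nearest unoccupied room to the left of $i$, and one violinist leaves room $i+1$ for the nearest unoccupied room to the right of $i+1$. Reachable means obtained by a finite (possibly empty) sequence of moves. A clusteron is a state whose occupied rooms form a nonempty set of consecutive rooms. A flat clusteron is a clusteron with exactly one violinist in each occupied room. A flat near-clusteron is a state with at most one violinist per room whose occupancy word, from leftmost to rightmost occupied room, contains exactly one $0$. -}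

module Defs where

open import Data.Nat using (ℕ; zero; suc) renaming (_+_ to _+ℕ_; _≤_ to _≤ℕ_)
open import Data.Integer using (ℤ; _+_; _-_; _<_; _≤_; _≟_; 1ℤ)
open import Data.Bool using (if_then_else_)
open import Data.Product using (Σ; ∃; _×_; _,_)
open import Data.Sum using (_⊎_)
open import Relation.Nullary using (¬_; does)
open import Relation.Binary.PropositionalEquality using (_≡_)
open import Relation.Binary.Construct.Closure.ReflexiveTransitive using (Star)

-- A state: number of violinists in each room (finite support is imposed
-- where needed; clusterons have finite support automatically).
State : Set
State = ℤ → ℕ

Occupied : State → ℤ → Set
Occupied a i = 1 ≤ℕ a i

Unoccupied : State → ℤ → Set
Unoccupied a i = a i ≡ 0

δ : ℤ → ℤ → ℕ
δ j k = if does (j ≟ k) then 1 else 0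

NearestLeftEmpty : State → ℤ → ℤ → Set
NearestLeftEmpty a i l = l < i × Unoccupied a l × (∀ k → l < k → k < i → Occupied a k)

NearestRightEmpty : State → ℤ → ℤ → Set
NearestRightEmpty a i r = i < r × Unoccupied a r × (∀ k → i < k → k < r → Occupied a k)

-- One move from a to b: rooms i, i+1 both occupied; one violinist goes from
-- room i to nearest empty room l left of i, one from room i+1 to nearest
-- empty room r right of i+1.  b is given pointwise:
--   b j = a j - [j=i] - [j=i+1] + [j=l] + [j=r]   (written without subtraction)
Move : State → State → Set
Move a b = Σ ℤ λ i → Σ ℤ λ l → Σ ℤ λ r →
  Occupied a i × Occupied a (i + 1ℤ) ×
  NearestLeftEmpty a i l × NearestRightEmpty a (i + 1ℤ) r ×
  (∀ j → b j +ℕ δ j i +ℕ δ j (i + 1ℤ) ≡ a j +ℕ δ j l +ℕ δ j r)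

Reachable : State → State → Set
Reachable = Star Move

ClusteronOn : State → ℤ → ℤ → Set
ClusteronOn a L R = L ≤ R ×
  (∀ j → (Occupied a j → L ≤ j × j ≤ R) × (L ≤ j × j ≤ R → Occupied a j))

Clusteron : State → Set
Clusteron a = ∃ λ L → ∃ λ R → ClusteronOn a L R

FlatClusteron : State → Set
FlatClusteron a = ∃ λ L → ∃ λ R → L ≤ R ×
  (∀ j → (L ≤ j × j ≤ R → a j ≡ 1) × (¬ (L ≤ j × j ≤ R) → a j ≡ 0))

FlatNearClusteron : State → Set
FlatNearClusteron a = (∀ j → a j ≤ℕ 1) × (∃ λ L → ∃ λ m → ∃ λ R →
  L < m × m < R ×
  (∀ j → (L ≤ j × j ≤ R × ¬ (j ≡ m) → a j ≡ 1) ×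
         (¬ (L ≤ j × j ≤ R) → a j ≡ 0) ×
         (j ≡ m → a j ≡ 0)))

-- Call a state admissible if it is a clusteron on at least two rooms, or a near-clusteron
-- (occupied rooms [A, B] minus one hole) whose end rooms A and B hold one violinist each.
-- In an admissible state a heavy room (two or more violinists) has an occupied neighbour in
-- its own maximal run, giving a pair (p, p + 1) inside that run; the move at this pair sends
-- one violinist to each of the two empty rooms bounding the run. The run thereby grows by one
-- room on each side (closing the hole, if it bounded the run), and a new hole can only appear
-- at whichever of p, p + 1 held a single violinist — not both, as one of them was heavy. So
-- the result is admissible again, and the total excess Σ (a j ∸ 1) has dropped. When no excess
-- is left every room holds at most one violinist: the state is a flat clusteron or a flat
-- near-clusteron.

module Submission where

open import Defs
open import Data.Nat using (ℕ; zero; suc; _∸_; s≤s; s≤s⁻¹; z≤n)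
  renaming (_+_ to _+ℕ_; _≤_ to _≤ℕ_; _<_ to _<ℕ_)
import Data.Nat.Properties as ℕ
import Data.Nat.Tactic.RingSolver as ℕ-Solver
open import Data.Integer using (ℤ; +_; _+_; _-_; _≤_; _<_; _≟_; 1ℤ; -1ℤ; _≤?_; _<?_; ∣_∣)
open import Data.Integer.Properties
  using (<-trans; ≤-<-trans; <-≤-trans; <⇒≤; <⇒≢; <⇒≱; ≤∧≢⇒<; <-irrefl; +-comm; +-identityʳ;
         ≤-reflexive; i<j⇒suc[i]≤j; suc[i]≤j⇒i<j; i<j⇒i≤pred[j]; ≰⇒>; ≮⇒≥; ∣-∣-≤; <-cmp)
open import Data.Integer.Tactic.RingSolver using (solve-∀)
open import Data.Empty using (⊥-elim)
open import Data.Product using (∃; _×_; _,_; proj₁; proj₂)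
open import Data.Sum using (_⊎_; inj₁; inj₂; [_,_]′)
open import Function using (_∘_)
open import Relation.Nullary using (¬_; yes; no)
open import Relation.Binary.PropositionalEquality
  using (_≡_; _≢_; refl; sym; trans; cong; cong₂; subst; ≢-sym; module ≡-Reasoning)
open import Relation.Binary.Definitions using (tri<; tri≈; tri>)
open import Relation.Binary.Construct.Closure.ReflexiveTransitive using (ε; _◅_)

private
  variable
    a : State
    f g : ℤ → ℕ
    i j lo : ℤ
    k : ℕ

i<i+1 : ∀ i → i < i + 1ℤ
i<i+1 i = suc[i]≤j⇒i<j (≤-reflexive (+-comm 1ℤ i))

i-1+1≡i : ∀ i → i - 1ℤ + 1ℤ ≡ i
i-1+1≡i = solve-∀

i-1<i : ∀ i → i - 1ℤ < i
i-1<i i = subst (i - 1ℤ <_) (i-1+1≡i i) (i<i+1 (i - 1ℤ))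

i<j⇒i+1≤j : i < j → i + 1ℤ ≤ j
i<j⇒i+1≤j {i} i<j = subst (_≤ _) (+-comm 1ℤ i) (i<j⇒suc[i]≤j i<j)

i<j+1⇒i≤j : i < j + 1ℤ → i ≤ j
i<j+1⇒i≤j {i} {j} h = subst (i ≤_) (-1+[j+1]≡j j) (i<j⇒i≤pred[j] h)
  where
  -1+[j+1]≡j : ∀ j → -1ℤ + (j + 1ℤ) ≡ j
  -1+[j+1]≡j = solve-∀

>⇒≢ : j < i → i ≢ j
>⇒≢ = ≢-sym ∘ <⇒≢

i-1<j⇒i≤j : i - 1ℤ < j → i ≤ j
i-1<j⇒i≤j {i} h = subst (_≤ _) (i-1+1≡i i) (i<j⇒i+1≤j h)

i<j⇒i≤j-1 : i < j → i ≤ j - 1ℤ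
i<j⇒i≤j-1 {j = j} h = i<j+1⇒i≤j (subst (_ <_) (sym (i-1+1≡i j)) h)

i<j⇒j≡i+1⊎i+1<j : i < j → j ≡ i + 1ℤ ⊎ i + 1ℤ < j
i<j⇒j≡i+1⊎i+1<j {i} {j} i<j with j ≟ i + 1ℤ
... | yes j≡i+1 = inj₁ j≡i+1
... | no j≢i+1 = inj₂ (≤∧≢⇒< (i<j⇒i+1≤j i<j) (j≢i+1 ∘ sym))

-- Sums over windows of rooms

InWindow : ℤ → ℕ → ℤ → Set
InWindow lo k j = lo ≤ j × j < lo + + k

sumFrom : (ℤ → ℕ) → ℤ → ℕ → ℕ
sumFrom f lo zero = 0
sumFrom f lo (suc k) = f lo +ℕ sumFrom f (lo + 1ℤ) k

lo+[1+k]≡lo+1+k : ∀ lo k → lo + + suc k ≡ lo + 1ℤ + + k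
lo+[1+k]≡lo+1+k lo k = shift lo (+ k)
  where
  shift : ∀ lo x → lo + (1ℤ + x) ≡ lo + 1ℤ + x
  shift = solve-∀

lo-1+[2+k]≡lo+k+1 : ∀ lo k → lo - 1ℤ + + (2 +ℕ k) ≡ lo + + k + 1ℤ
lo-1+[2+k]≡lo+k+1 lo k = shift lo (+ k)
  where
  shift : ∀ lo x → lo - 1ℤ + (1ℤ + (1ℤ + x)) ≡ lo + x + 1ℤ
  shift = solve-∀

¬InWindow-0 : ¬ InWindow lo 0 j
¬InWindow-0 {lo} (lo≤j , j<lo+0) = <-irrefl refl (≤-<-trans lo≤j (subst (_ <_) (+-identityʳ lo) j<lo+0))

lo-1∉InWindow : ¬ InWindow lo k (lo - 1ℤ)
lo-1∉InWindow {lo} (lo≤lo-1 , _) = <-irrefl refl (<-≤-trans (i-1<i lo) lo≤lo-1)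

lo+k∉InWindow : ¬ InWindow lo k (lo + + k)
lo+k∉InWindow (_ , lo+k<lo+k) = <-irrefl refl lo+k<lo+k

InWindow-tail : InWindow lo (suc k) j → j ≢ lo → InWindow (lo + 1ℤ) k j
InWindow-tail {lo} {k} (lo≤j , j<) j≢lo =
  i<j⇒i+1≤j (≤∧≢⇒< lo≤j (j≢lo ∘ sym)) , subst (_ <_) (lo+[1+k]≡lo+1+k lo k) j<

sumFrom-mono-≤ : (∀ j → f j ≤ℕ g j) → ∀ lo k → sumFrom f lo k ≤ℕ sumFrom g lo k
sumFrom-mono-≤ f≤g lo zero = z≤n
sumFrom-mono-≤ f≤g lo (suc k) = ℕ.+-mono-≤ (f≤g lo) (sumFrom-mono-≤ f≤g (lo + 1ℤ) k)

sumFrom-mono-< : (∀ j → f j ≤ℕ g j) → InWindow lo k j → f j <ℕ g j →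
                 sumFrom f lo k <ℕ sumFrom g lo k
sumFrom-mono-< {k = zero} f≤g w _ = ⊥-elim (¬InWindow-0 w)
sumFrom-mono-< {lo = lo} {k = suc k} {j = j} f≤g w fj<gj with j ≟ lo
... | yes refl = ℕ.+-mono-<-≤ fj<gj (sumFrom-mono-≤ f≤g (lo + 1ℤ) k)
... | no j≢lo = ℕ.+-mono-≤-< (f≤g lo) (sumFrom-mono-< f≤g (InWindow-tail w j≢lo) fj<gj)

sumFrom≡0⇒≡0 : sumFrom f lo k ≡ 0 → InWindow lo k j → f j ≡ 0
sumFrom≡0⇒≡0 {k = zero} _ w = ⊥-elim (¬InWindow-0 w)
sumFrom≡0⇒≡0 {f = f} {lo = lo} {k = suc k} {j = j} sum≡0 w with j ≟ lo
... | yes refl = ℕ.m+n≡0⇒m≡0 (f j) sum≡0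
... | no j≢lo = sumFrom≡0⇒≡0 (ℕ.m+n≡0⇒n≡0 (f lo) sum≡0) (InWindow-tail w j≢lo)

sumFrom>0⇒∃>0 : 0 <ℕ sumFrom f lo k → ∃ λ j → 0 <ℕ f j
sumFrom>0⇒∃>0 {k = zero} ()
sumFrom>0⇒∃>0 {f = f} {lo = lo} {k = suc k} sum>0 with f lo in eq
... | zero = sumFrom>0⇒∃>0 {f = f} {lo = lo + 1ℤ} {k = k} sum>0
... | suc _ = lo , subst (0 <ℕ_) (sym eq) (s≤s z≤n)

sumFrom-snoc : ∀ f lo k → sumFrom f lo (suc k) ≡ sumFrom f lo k +ℕ f (lo + + k)
sumFrom-snoc f lo zero = trans (ℕ.+-identityʳ (f lo)) (cong f (sym (+-identityʳ lo)))
sumFrom-snoc f lo (suc k) = begin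
  f lo +ℕ sumFrom f (lo + 1ℤ) (suc k)
    ≡⟨ cong (f lo +ℕ_) (sumFrom-snoc f (lo + 1ℤ) k) ⟩
  f lo +ℕ (sumFrom f (lo + 1ℤ) k +ℕ f (lo + 1ℤ + + k))
    ≡⟨ sym (ℕ.+-assoc (f lo) _ _) ⟩
  f lo +ℕ sumFrom f (lo + 1ℤ) k +ℕ f (lo + 1ℤ + + k)
    ≡⟨ cong (λ i → sumFrom f lo (suc k) +ℕ f i) (sym (lo+[1+k]≡lo+1+k lo k)) ⟩
  sumFrom f lo (suc k) +ℕ f (lo + + suc k) ∎
  where open ≡-Reasoning

sumFrom-widen : f (lo - 1ℤ) ≡ 0 → f (lo + + k) ≡ 0 →
                sumFrom f (lo - 1ℤ) (2 +ℕ k) ≡ sumFrom f lo k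
sumFrom-widen {f = f} {lo = lo} {k = k} below above = begin
  f (lo - 1ℤ) +ℕ sumFrom f (lo - 1ℤ + 1ℤ) (suc k)
    ≡⟨ cong₂ _+ℕ_ below (cong (λ i → sumFrom f i (suc k)) (i-1+1≡i lo)) ⟩
  sumFrom f lo (suc k)
    ≡⟨ sumFrom-snoc f lo k ⟩
  sumFrom f lo k +ℕ f (lo + + k)
    ≡⟨ cong (sumFrom f lo k +ℕ_) above ⟩
  sumFrom f lo k +ℕ 0
    ≡⟨ ℕ.+-identityʳ _ ⟩
  sumFrom f lo k ∎
  where open ≡-Reasoning

vacant-or-occupied : ∀ n → n ≡ 0 ⊎ 1 ≤ℕ n
vacant-or-occupied zero = inj₁ refl
vacant-or-occupied (suc n) = inj₂ (s≤s z≤n)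

vacant⇒¬occupied : ∀ {n} → n ≡ 0 → ¬ 1 ≤ℕ n
vacant⇒¬occupied refl ()

¬occupied⇒vacant : ¬ Occupied a j → a j ≡ 0
¬occupied⇒vacant ¬occ = ℕ.n<1⇒n≡0 (ℕ.≰⇒> ¬occ)

excess : State → ℤ → ℕ
excess a j = a j ∸ 1

excessIn : State → ℤ → ℕ → ℕ
excessIn a = sumFrom (excess a)

SupportedIn : State → ℤ → ℕ → Set
SupportedIn a lo k = ∀ j → Occupied a j → InWindow lo k j

SupportedIn⇒vacant : SupportedIn a lo k → ¬ InWindow lo k j → a j ≡ 0
SupportedIn⇒vacant {a = a} {j = j} sup ∉w = ¬occupied⇒vacant {a = a} (∉w ∘ sup j)

InWindow-widen : InWindow lo k j → InWindow (lo - 1ℤ) (2 +ℕ k) j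
InWindow-widen {lo} {k} {j} (lo≤j , j<lo+k) =
  <⇒≤ (<-≤-trans (i-1<i lo) lo≤j) ,
  subst (j <_) (sym (lo-1+[2+k]≡lo+k+1 lo k)) (<-trans j<lo+k (i<i+1 _))

InWindow-widen-pred : InWindow lo k (j + 1ℤ) → InWindow (lo - 1ℤ) (2 +ℕ k) j
InWindow-widen-pred {lo} {k} {j} w@(lo≤j+1 , _) =
  i<j+1⇒i≤j (<-≤-trans (i-1<i lo) lo≤j+1) , <-trans (i<i+1 j) (proj₂ (InWindow-widen w))

InWindow-widen-suc : InWindow lo k (j - 1ℤ) → InWindow (lo - 1ℤ) (2 +ℕ k) j
InWindow-widen-suc {lo} {k} {j} (lo≤j-1 , j-1<lo+k) =
  <⇒≤ (<-≤-trans (i-1<i lo) (<⇒≤ (≤-<-trans lo≤j-1 (i-1<i j)))) ,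
  subst (j <_) (sym (lo-1+[2+k]≡lo+k+1 lo k)) (≤-<-trans (i-1<j⇒i≤j j-1<lo+k) (i<i+1 _))

-- Moves

δ-refl : ∀ j → δ j j ≡ 1
δ-refl j with j ≟ j
... | yes _ = refl
... | no j≢j = ⊥-elim (j≢j refl)

δ-≢ : j ≢ i → δ j i ≡ 0
δ-≢ {j} {i} j≢i with j ≟ i
... | yes j≡i = ⊥-elim (j≢i j≡i)
... | no _ = refl

-- Split on δ-cases rather than on j ≟ i: with-abstracting j ≟ i would also rewrite the
-- occurrences of j ≟ i hidden inside δ in the goal, blocking later rewrites by δ-refl and δ-≢.
δ-cases : ∀ j i → (j ≡ i × δ j i ≡ 1) ⊎ (j ≢ i × δ j i ≡ 0)
δ-cases j i with j ≟ i
... | yes j≡i = inj₁ (j≡i , refl)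
... | no j≢i = inj₂ (j≢i , refl)

-- The additions come first so that, once every δ is rewritten to a constant, each value of
-- moved reduces definitionally.
moved : State → ℤ → ℤ → ℤ → State
moved a l p r j = δ j l +ℕ δ j r +ℕ (a j ∸ δ j p ∸ δ j (p + 1ℤ))

moved-balance : ∀ x u v w z → u +ℕ v ≤ℕ x → w +ℕ z +ℕ (x ∸ u ∸ v) +ℕ u +ℕ v ≡ x +ℕ w +ℕ z
moved-balance x u v w z u+v≤x = begin
  w +ℕ z +ℕ (x ∸ u ∸ v) +ℕ u +ℕ v   ≡⟨ cong (λ y → w +ℕ z +ℕ y +ℕ u +ℕ v) (ℕ.∸-+-assoc x u v) ⟩
  w +ℕ z +ℕ (x ∸ (u +ℕ v)) +ℕ u +ℕ v ≡⟨ rearrange (x ∸ (u +ℕ v)) u v w z ⟩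
  x ∸ (u +ℕ v) +ℕ (u +ℕ v) +ℕ w +ℕ z ≡⟨ cong (λ y → y +ℕ w +ℕ z) (ℕ.m∸n+n≡m u+v≤x) ⟩
  x +ℕ w +ℕ z                        ∎
  where
  open ≡-Reasoning
  rearrange : ∀ y u v w z → w +ℕ z +ℕ y +ℕ u +ℕ v ≡ y +ℕ (u +ℕ v) +ℕ w +ℕ z
  rearrange = ℕ-Solver.solve-∀

-- Shapes of states

record VanishesOutside (a : State) (X Y : ℤ) : Set where
  field
    below : ∀ j → j < X → a j ≡ 0
    above : ∀ j → Y < j → a j ≡ 0

  occupied⇒within : ∀ j → Occupied a j → X ≤ j × j ≤ Y
  occupied⇒within j occ with X ≤? j | j ≤? Y
  ... | no X≰j | _ = ⊥-elim (vacant⇒¬occupied (below j (≰⇒> X≰j)) occ)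
  ... | yes _ | no j≰Y = ⊥-elim (vacant⇒¬occupied (above j (≰⇒> j≰Y)) occ)
  ... | yes X≤j | yes j≤Y = X≤j , j≤Y

  ¬within⇒vacant : ¬ (X ≤ j × j ≤ Y) → a j ≡ 0
  ¬within⇒vacant ¬within = ¬occupied⇒vacant {a = a} (¬within ∘ occupied⇒within _)

record Cluster (a : State) (L R : ℤ) : Set where
  field
    L<R : L < R
    occupied : ∀ j → L ≤ j → j ≤ R → Occupied a j
    vanishes : VanishesOutside a L R
  open VanishesOutside vanishes public

record NearCluster (a : State) (A h B : ℤ) : Set where
  field
    A<h : A < h
    h<B : h < B
    -- so that a heavy room always has an occupied neighbour in its own run
    left-end : a A ≡ 1
    right-end : a B ≡ 1
    hole : a h ≡ 0
    occupied-below-hole : ∀ j → A ≤ j → j < h → Occupied a j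
    occupied-above-hole : ∀ j → h < j → j ≤ B → Occupied a j
    vanishes : VanishesOutside a A B
  open VanishesOutside vanishes public

  occupied : A ≤ j → j ≤ B → j ≢ h → Occupied a j
  occupied {j} A≤j j≤B j≢h with <-cmp j h
  ... | tri< j<h _ _ = occupied-below-hole j A≤j j<h
  ... | tri≈ _ j≡h _ = ⊥-elim (j≢h j≡h)
  ... | tri> _ _ h<j = occupied-above-hole j h<j j≤B

Admissible : State → Set
Admissible a = (∃ λ L → ∃ λ R → Cluster a L R) ⊎ (∃ λ A → ∃ λ h → ∃ λ B → NearCluster a A h B)

cluster⇒flat : ∀ {L R} → Cluster a L R → (∀ j → a j ≤ℕ 1) → FlatClusteron a
cluster⇒flat {L = L} {R} c light =
  L , R , <⇒≤ L<R , λ j → (λ (L≤j , j≤R) → ℕ.≤-antisym (light j) (occupied j L≤j j≤R)) , ¬within⇒vacant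
  where open Cluster c

near⇒flat : ∀ {A h B} → NearCluster a A h B → (∀ j → a j ≤ℕ 1) → FlatNearClusteron a
near⇒flat {A = A} {h} {B} n light =
  light , A , h , B , A<h , h<B ,
  λ j → (λ (A≤j , j≤B , j≢h) → ℕ.≤-antisym (light j) (occupied A≤j j≤B j≢h)) ,
        ¬within⇒vacant ,
        λ { refl → hole }
  where open NearCluster n

admissible⇒flat : Admissible a → (∀ j → a j ≤ℕ 1) → FlatClusteron a ⊎ FlatNearClusteron a
admissible⇒flat (inj₁ (_ , _ , c)) light = inj₁ (cluster⇒flat c light)
admissible⇒flat (inj₂ (_ , _ , _ , n)) light = inj₂ (near⇒flat n light)

-- What a move at (p, p + 1) leaves behind, before knowing whether p and p + 1 stay occupied.
record Spread (a : State) (X p Y : ℤ) : Set where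
  field
    X<p : X < p
    p+1<Y : p + 1ℤ < Y
    left-end : a X ≡ 1
    right-end : a Y ≡ 1
    occupied-left : ∀ j → X ≤ j → j < p → Occupied a j
    occupied-right : ∀ j → p + 1ℤ < j → j ≤ Y → Occupied a j
    vanishes : VanishesOutside a X Y

  p<Y : p < Y
  p<Y = <-trans (i<i+1 p) p+1<Y

  occupied-above-p : Occupied a (p + 1ℤ) → ∀ j → p < j → j ≤ Y → Occupied a j
  occupied-above-p occ-p+1 j p<j j≤Y with i<j⇒j≡i+1⊎i+1<j p<j
  ... | inj₁ refl = occ-p+1
  ... | inj₂ p+1<j = occupied-right j p+1<j j≤Y

  occupied-below-p+1 : Occupied a p → ∀ j → X ≤ j → j < p + 1ℤ → Occupied a j
  occupied-below-p+1 occ-p j X≤j j<p+1 with j ≟ p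
  ... | yes refl = occ-p
  ... | no j≢p = occupied-left j X≤j (≤∧≢⇒< (i<j+1⇒i≤j j<p+1) j≢p)

  cluster : Occupied a p → Occupied a (p + 1ℤ) → Cluster a X Y
  cluster occ-p occ-p+1 = record
    { L<R = <-trans X<p p<Y
    ; occupied = occupied
    ; vanishes = vanishes
    }
    where
    occupied : ∀ j → X ≤ j → j ≤ Y → Occupied a j
    occupied j X≤j j≤Y with <-cmp j p
    ... | tri< j<p _ _ = occupied-left j X≤j j<p
    ... | tri≈ _ refl _ = occ-p
    ... | tri> _ _ p<j = occupied-above-p occ-p+1 j p<j j≤Y

  near-cluster-at-p : a p ≡ 0 → Occupied a (p + 1ℤ) → NearCluster a X p Y
  near-cluster-at-p vacant-p occ-p+1 = record
    { A<h = X<p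
    ; h<B = p<Y
    ; left-end = left-end
    ; right-end = right-end
    ; hole = vacant-p
    ; occupied-below-hole = occupied-left
    ; occupied-above-hole = occupied-above-p occ-p+1
    ; vanishes = vanishes
    }

  near-cluster-at-p+1 : Occupied a p → a (p + 1ℤ) ≡ 0 → NearCluster a X (p + 1ℤ) Y
  near-cluster-at-p+1 occ-p vacant-p+1 = record
    { A<h = <-trans X<p (i<i+1 p)
    ; h<B = p+1<Y
    ; left-end = left-end
    ; right-end = right-end
    ; hole = vacant-p+1
    ; occupied-below-hole = occupied-below-p+1 occ-p
    ; occupied-above-hole = occupied-right
    ; vanishes = vanishes
    }

  admissible : Occupied a p ⊎ Occupied a (p + 1ℤ) → Admissible a
  admissible occ with vacant-or-occupied (a p) | vacant-or-occupied (a (p + 1ℤ))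
  ... | inj₂ occ-p | inj₂ occ-p+1 = inj₁ (_ , _ , cluster occ-p occ-p+1)
  ... | inj₁ vacant-p | inj₂ occ-p+1 = inj₂ (_ , _ , _ , near-cluster-at-p vacant-p occ-p+1)
  ... | inj₂ occ-p | inj₁ vacant-p+1 = inj₂ (_ , _ , _ , near-cluster-at-p+1 occ-p vacant-p+1)
  ... | inj₁ vacant-p | inj₁ vacant-p+1 =
    ⊥-elim ([ vacant⇒¬occupied vacant-p , vacant⇒¬occupied vacant-p+1 ]′ occ)

HeavyPair : State → ℤ → Set
HeavyPair a p = 2 ≤ℕ a p ⊎ 2 ≤ℕ a (p + 1ℤ)

record Step (a : State) (lo : ℤ) (k : ℕ) : Set where
  field
    next : State
    move : Move a next
    admissible : Admissible next
    supported : SupportedIn next (lo - 1ℤ) (2 +ℕ k)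
    decreasing : excessIn next (lo - 1ℤ) (2 +ℕ k) <ℕ excessIn a lo k

record Run (a : State) (l r : ℤ) : Set where
  field
    left-empty : a l ≡ 0
    right-empty : a r ≡ 0
    occupied : ∀ j → l < j → j < r → Occupied a j

module RunMove {a : State} {l p r : ℤ} (run : Run a l r) (l<p : l < p) (p+1<r : p + 1ℤ < r) where
  open Run run

  b : State
  b = moved a l p r

  private
    p<p+1 : p < p + 1ℤ
    p<p+1 = i<i+1 p
    l<p+1 : l < p + 1ℤ
    l<p+1 = <-trans l<p p<p+1
    p<r : p < r
    p<r = <-trans p<p+1 p+1<r
    l<r : l < r
    l<r = <-trans l<p p<r

  b-l : b l ≡ 1
  b-l rewrite δ-refl l | δ-≢ (<⇒≢ l<r) | δ-≢ (<⇒≢ l<p) | δ-≢ (<⇒≢ l<p+1) | left-empty = refl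

  b-r : b r ≡ 1
  b-r rewrite δ-refl r | δ-≢ (>⇒≢ l<r) | δ-≢ (>⇒≢ p<r) | δ-≢ (>⇒≢ p+1<r) | right-empty = refl

  b-p : b p ≡ a p ∸ 1
  b-p rewrite δ-refl p | δ-≢ (>⇒≢ l<p) | δ-≢ (<⇒≢ p<r) | δ-≢ (<⇒≢ p<p+1) = refl

  b-p+1 : b (p + 1ℤ) ≡ a (p + 1ℤ) ∸ 1
  b-p+1 rewrite δ-refl (p + 1ℤ) | δ-≢ (>⇒≢ l<p+1) | δ-≢ (<⇒≢ p+1<r) | δ-≢ (>⇒≢ p<p+1) = refl

  unchanged : j ≢ l → j ≢ r → j ≢ p → j ≢ p + 1ℤ → b j ≡ a j
  unchanged j≢l j≢r j≢p j≢p+1 rewrite δ-≢ j≢l | δ-≢ j≢r | δ-≢ j≢p | δ-≢ j≢p+1 = refl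

  b≤a : j ≢ l → j ≢ r → b j ≤ℕ a j
  b≤a {j} j≢l j≢r rewrite δ-≢ j≢l | δ-≢ j≢r =
    ℕ.≤-trans (ℕ.m∸n≤m _ (δ j (p + 1ℤ))) (ℕ.m∸n≤m (a j) (δ j p))

  occupied-p : Occupied a p
  occupied-p = occupied p l<p p<r

  occupied-p+1 : Occupied a (p + 1ℤ)
  occupied-p+1 = occupied (p + 1ℤ) l<p+1 p+1<r

  move : Move a b
  move = p , l , r , occupied-p , occupied-p+1
       , (l<p , left-empty , λ j l<j j<p → occupied j l<j (<-trans j<p p<r))
       , (p+1<r , right-empty , λ j p+1<j j<r → occupied j (<-trans l<p+1 p+1<j) j<r)
       , λ j → moved-balance (a j) (δ j p) (δ j (p + 1ℤ)) (δ j l) (δ j r) (leaving j)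
    where
    leaving : ∀ j → δ j p +ℕ δ j (p + 1ℤ) ≤ℕ a j
    leaving j with δ-cases j p | δ-cases j (p + 1ℤ)
    ... | inj₁ (refl , δ≡1) | _ rewrite δ≡1 | δ-≢ (<⇒≢ p<p+1) = occupied-p
    ... | inj₂ (_ , δ≡0) | inj₁ (refl , δ′≡1) rewrite δ≡0 | δ′≡1 = occupied-p+1
    ... | inj₂ (_ , δ≡0) | inj₂ (_ , δ′≡0) rewrite δ≡0 | δ′≡0 = z≤n

  unchanged-below : j < l → b j ≡ a j
  unchanged-below j<l =
    unchanged (<⇒≢ j<l) (<⇒≢ (<-trans j<l l<r)) (<⇒≢ (<-trans j<l l<p)) (<⇒≢ (<-trans j<l l<p+1))

  unchanged-above : r < j → b j ≡ a j
  unchanged-above r<j =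
    unchanged (>⇒≢ (<-trans l<r r<j)) (>⇒≢ r<j) (>⇒≢ (<-trans p<r r<j)) (>⇒≢ (<-trans p+1<r r<j))

  occupied-left : ∀ j → l ≤ j → j < p → Occupied b j
  occupied-left j l≤j j<p with δ-cases j l
  ... | inj₁ (refl , _) = ℕ.≤-reflexive (sym b-l)
  ... | inj₂ (j≢l , _) = subst (1 ≤ℕ_) (sym b≡a) (occupied j l<j (<-trans j<p p<r))
    where
    l<j = ≤∧≢⇒< l≤j (≢-sym j≢l)
    b≡a = unchanged j≢l (<⇒≢ (<-trans j<p p<r)) (<⇒≢ j<p) (<⇒≢ (<-trans j<p p<p+1))

  occupied-right : ∀ j → p + 1ℤ < j → j ≤ r → Occupied b j
  occupied-right j p+1<j j≤r with δ-cases j r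
  ... | inj₁ (refl , _) = ℕ.≤-reflexive (sym b-r)
  ... | inj₂ (j≢r , _) = subst (1 ≤ℕ_) (sym b≡a) (occupied j (<-trans l<p+1 p+1<j) j<r)
    where
    j<r = ≤∧≢⇒< j≤r j≢r
    b≡a = unchanged (>⇒≢ (<-trans l<p+1 p+1<j)) j≢r (>⇒≢ (<-trans p<p+1 p+1<j)) (>⇒≢ p+1<j)

  excess-≤ : ∀ j → excess b j ≤ℕ excess a j
  excess-≤ j with δ-cases j l | δ-cases j r
  ... | inj₁ (refl , _) | _ = subst (λ n → n ∸ 1 ≤ℕ excess a l) (sym b-l) z≤n
  ... | inj₂ _ | inj₁ (refl , _) = subst (λ n → n ∸ 1 ≤ℕ excess a r) (sym b-r) z≤n
  ... | inj₂ (j≢l , _) | inj₂ (j≢r , _) = ℕ.∸-monoˡ-≤ 1 (b≤a j≢l j≢r)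

  heavy⇒excess-< : ∀ {j} → b j ≡ a j ∸ 1 → 2 ≤ℕ a j → excess b j <ℕ excess a j
  heavy⇒excess-< {j} b≡a-1 heavy = subst (λ n → n ∸ 1 <ℕ excess a j) (sym b≡a-1) (lemma heavy)
    where
    lemma : ∀ {n} → 2 ≤ℕ n → n ∸ 1 ∸ 1 <ℕ n ∸ 1
    lemma (s≤s (s≤s _)) = ℕ.n<1+n _

  heavy⇒occupied : ∀ {j} → b j ≡ a j ∸ 1 → 2 ≤ℕ a j → Occupied b j
  heavy⇒occupied b≡a-1 heavy = subst (1 ≤ℕ_) (sym b≡a-1) (ℕ.∸-monoˡ-≤ 1 heavy)

  supported : SupportedIn a lo k → SupportedIn b (lo - 1ℤ) (2 +ℕ k)
  supported sup j occ with δ-cases j l | δ-cases j r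
  ... | inj₁ (refl , _) | _ = InWindow-widen-pred (sup (l + 1ℤ) (occupied (l + 1ℤ) (i<i+1 l) l+1<r))
    where l+1<r = ≤-<-trans (i<j⇒i+1≤j l<p) p<r
  ... | inj₂ _ | inj₁ (refl , _) = InWindow-widen-suc (sup (r - 1ℤ) (occupied (r - 1ℤ) l<r-1 (i-1<i r)))
    where l<r-1 = <-≤-trans l<p+1 (i<j⇒i≤j-1 p+1<r)
  ... | inj₂ (j≢l , _) | inj₂ (j≢r , _) = InWindow-widen (sup j (ℕ.≤-trans occ (b≤a j≢l j≢r)))

  decreasing : SupportedIn a lo k → HeavyPair a p →
               excessIn b (lo - 1ℤ) (2 +ℕ k) <ℕ excessIn a lo k
  decreasing {lo} {k} sup heavy = subst (excessIn b (lo - 1ℤ) (2 +ℕ k) <ℕ_) widen-a (strict heavy)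
    where
    widen-a : excessIn a (lo - 1ℤ) (2 +ℕ k) ≡ excessIn a lo k
    widen-a = sumFrom-widen {f = excess a} {lo} {k}
      (cong (_∸ 1) (SupportedIn⇒vacant {a = a} {lo} {k} sup lo-1∉InWindow))
      (cong (_∸ 1) (SupportedIn⇒vacant {a = a} {lo} {k} sup lo+k∉InWindow))
    strict : HeavyPair a p → excessIn b (lo - 1ℤ) (2 +ℕ k) <ℕ excessIn a (lo - 1ℤ) (2 +ℕ k)
    strict (inj₁ heavy-p) =
      sumFrom-mono-< excess-≤ (InWindow-widen (sup p occupied-p)) (heavy⇒excess-< b-p heavy-p)
    strict (inj₂ heavy-p+1) =
      sumFrom-mono-< excess-≤ (InWindow-widen (sup (p + 1ℤ) occupied-p+1)) (heavy⇒excess-< b-p+1 heavy-p+1)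

  step : ∀ {X Y} → HeavyPair a p → Spread b X p Y → SupportedIn a lo k → Step a lo k
  step heavy spread sup = record
    { next = b
    ; move = move
    ; admissible = Spread.admissible spread (
        [ inj₁ ∘ heavy⇒occupied b-p , inj₂ ∘ heavy⇒occupied b-p+1 ]′ heavy)
    ; supported = supported sup
    ; decreasing = decreasing sup heavy
    }

heavy⇒HeavyPair-pred : 2 ≤ℕ a j → HeavyPair a (j - 1ℤ)
heavy⇒HeavyPair-pred {a} {j} heavy = inj₂ (subst (λ i → 2 ≤ℕ a i) (sym (i-1+1≡i j)) heavy)

heavy⇒≢ : a i ≡ 1 → 2 ≤ℕ a j → j ≢ i
heavy⇒≢ a-i≡1 heavy refl = ℕ.<⇒≢ heavy (sym a-i≡1)

module _ {a : State} {L R : ℤ} (c : Cluster a L R) where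
  open Cluster c

  cluster-step : ∀ {p} → L ≤ p → p + 1ℤ ≤ R → HeavyPair a p → SupportedIn a lo k → Step a lo k
  cluster-step {p = p} L≤p p+1≤R heavy = step heavy spread
    where
    run : Run a (L - 1ℤ) (R + 1ℤ)
    run = record
      { left-empty = below (L - 1ℤ) (i-1<i L)
      ; right-empty = above (R + 1ℤ) (i<i+1 R)
      ; occupied = λ j L-1<j j<R+1 → occupied j (i-1<j⇒i≤j L-1<j) (i<j+1⇒i≤j j<R+1)
      }
    open RunMove run (<-≤-trans (i-1<i L) L≤p) (≤-<-trans p+1≤R (i<i+1 R))
    spread : Spread b (L - 1ℤ) p (R + 1ℤ)
    spread = record
      { X<p = <-≤-trans (i-1<i L) L≤p
      ; p+1<Y = ≤-<-trans p+1≤R (i<i+1 R)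
      ; left-end = b-l
      ; right-end = b-r
      ; occupied-left = occupied-left
      ; occupied-right = occupied-right
      ; vanishes = record
        { below = λ j j<L-1 → trans (unchanged-below j<L-1) (below j (<-trans j<L-1 (i-1<i L)))
        ; above = λ j R+1<j → trans (unchanged-above R+1<j) (above j (<-trans (i<i+1 R) R+1<j))
        }
      }

  cluster-heavy-step : 2 ≤ℕ a j → SupportedIn a lo k → Step a lo k
  cluster-heavy-step {j} heavy with occupied⇒within j (ℕ.<⇒≤ heavy) | j <? R
  ... | L≤j , _ | yes j<R = cluster-step L≤j (i<j⇒i+1≤j j<R) (inj₁ heavy)
  ... | _ , j≤R | no j≮R =
    cluster-step (i<j⇒i≤j-1 (<-≤-trans L<R (≮⇒≥ j≮R))) (subst (_≤ R) (sym (i-1+1≡i j)) j≤R)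
                 (heavy⇒HeavyPair-pred {a = a} heavy)

module _ {a : State} {A h B : ℤ} (n : NearCluster a A h B) where
  open NearCluster n

  near-step-below-hole : ∀ {p} → A ≤ p → p + 1ℤ < h → HeavyPair a p → SupportedIn a lo k → Step a lo k
  near-step-below-hole {p = p} A≤p p+1<h heavy = step heavy spread
    where
    run : Run a (A - 1ℤ) h
    run = record
      { left-empty = below (A - 1ℤ) (i-1<i A)
      ; right-empty = hole
      ; occupied = λ j A-1<j j<h → occupied-below-hole j (i-1<j⇒i≤j A-1<j) j<h
      }
    open RunMove run (<-≤-trans (i-1<i A) A≤p) p+1<h
    occupied-above : ∀ j → p + 1ℤ < j → j ≤ B → Occupied b j
    occupied-above j p+1<j j≤B with j ≤? h
    ... | yes j≤h = occupied-right j p+1<j j≤h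
    ... | no j≰h = subst (1 ≤ℕ_) (sym (unchanged-above (≰⇒> j≰h))) (occupied-above-hole j (≰⇒> j≰h) j≤B)
    spread : Spread b (A - 1ℤ) p B
    spread = record
      { X<p = <-≤-trans (i-1<i A) A≤p
      ; p+1<Y = <-trans p+1<h h<B
      ; left-end = b-l
      ; right-end = trans (unchanged-above h<B) right-end
      ; occupied-left = occupied-left
      ; occupied-right = occupied-above
      ; vanishes = record
        { below = λ j j<A-1 → trans (unchanged-below j<A-1) (below j (<-trans j<A-1 (i-1<i A)))
        ; above = λ j B<j → trans (unchanged-above (<-trans h<B B<j)) (above j B<j)
        }
      }

  near-step-above-hole : ∀ {p} → h < p → p + 1ℤ ≤ B → HeavyPair a p → SupportedIn a lo k → Step a lo k
  near-step-above-hole {p = p} h<p p+1≤B heavy = step heavy spread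
    where
    run : Run a h (B + 1ℤ)
    run = record
      { left-empty = hole
      ; right-empty = above (B + 1ℤ) (i<i+1 B)
      ; occupied = λ j h<j j<B+1 → occupied-above-hole j h<j (i<j+1⇒i≤j j<B+1)
      }
    open RunMove run h<p (≤-<-trans p+1≤B (i<i+1 B))
    occupied-below : ∀ j → A ≤ j → j < p → Occupied b j
    occupied-below j A≤j j<p with h ≤? j
    ... | yes h≤j = occupied-left j h≤j j<p
    ... | no h≰j = subst (1 ≤ℕ_) (sym (unchanged-below (≰⇒> h≰j))) (occupied-below-hole j A≤j (≰⇒> h≰j))
    spread : Spread b A p (B + 1ℤ)
    spread = record
      { X<p = <-trans A<h h<p
      ; p+1<Y = ≤-<-trans p+1≤B (i<i+1 B)
      ; left-end = trans (unchanged-below A<h) left-end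
      ; right-end = b-r
      ; occupied-left = occupied-below
      ; occupied-right = occupied-right
      ; vanishes = record
        { below = λ j j<A → trans (unchanged-below (<-trans j<A A<h)) (below j j<A)
        ; above = λ j B+1<j → trans (unchanged-above B+1<j) (above j (<-trans (i<i+1 B) B+1<j))
        }
      }

  near-heavy-step : 2 ≤ℕ a j → SupportedIn a lo k → Step a lo k
  near-heavy-step {j} heavy with occupied⇒within j (ℕ.<⇒≤ heavy) | <-cmp j h
  ... | A≤j , _ | tri< j<h _ _ =
    near-step-below-hole (i<j⇒i≤j-1 (≤∧≢⇒< A≤j (≢-sym (heavy⇒≢ {a = a} left-end heavy))))
                         (subst (_< h) (sym (i-1+1≡i j)) j<h) (heavy⇒HeavyPair-pred {a = a} heavy)
  ... | _ | tri≈ _ refl _ = ⊥-elim (vacant⇒¬occupied hole (ℕ.<⇒≤ heavy))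
  ... | _ , j≤B | tri> _ _ h<j =
    near-step-above-hole h<j (i<j⇒i+1≤j (≤∧≢⇒< j≤B (heavy⇒≢ {a = a} right-end heavy))) (inj₁ heavy)

heavy-step : Admissible a → 2 ≤ℕ a j → SupportedIn a lo k → Step a lo k
heavy-step (inj₁ (_ , _ , c)) = cluster-heavy-step c
heavy-step (inj₂ (_ , _ , _ , n)) = near-heavy-step n

light-or-heavy : SupportedIn a lo k → (∀ j → a j ≤ℕ 1) ⊎ ∃ λ j → 2 ≤ℕ a j
light-or-heavy {a} {lo} {k} sup with excessIn a lo k ℕ.≟ 0
... | yes no-excess = inj₁ light
  where
  light : ∀ j → a j ≤ℕ 1
  light j with vacant-or-occupied (a j)
  ... | inj₁ vacant = ℕ.≤-trans (ℕ.≤-reflexive vacant) z≤n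
  ... | inj₂ occ = ℕ.m∸n≡0⇒m≤n (sumFrom≡0⇒≡0 {f = excess a} {lo} {k} no-excess (sup j occ))
... | no some-excess with sumFrom>0⇒∃>0 {f = excess a} {lo} {k} (ℕ.n≢0⇒n>0 some-excess)
...   | j , excess>0 = inj₂ (j , excess>0⇒heavy excess>0)
  where
  excess>0⇒heavy : ∀ {n} → 0 <ℕ n ∸ 1 → 2 ≤ℕ n
  excess>0⇒heavy {suc (suc _)} _ = s≤s (s≤s z≤n)

settle : ∀ n → excessIn a lo k <ℕ n → SupportedIn a lo k → Admissible a →
         ∃ λ D → Reachable a D × (FlatClusteron D ⊎ FlatNearClusteron D)
settle (suc n) bound sup adm with light-or-heavy sup
... | inj₁ light = _ , ε , admissible⇒flat adm light
... | inj₂ (_ , heavy) =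
  let open Step (heavy-step adm heavy sup)
      D , next↝D , flat = settle n (ℕ.<-≤-trans decreasing (s≤s⁻¹ bound)) supported admissible
  in  D , move ◅ next↝D , flat

clusteronOn⇒cluster : ∀ {L R} → ClusteronOn a L R → L < R → Cluster a L R
clusteronOn⇒cluster {a} (_ , clusteron) L<R = record
  { L<R = L<R
  ; occupied = λ j L≤j j≤R → proj₂ (clusteron j) (L≤j , j≤R)
  ; vanishes = record
    { below = λ j j<L → ¬occupied⇒vacant {a = a} (<⇒≱ j<L ∘ proj₁ ∘ proj₁ (clusteron j))
    ; above = λ j R<j → ¬occupied⇒vacant {a = a} (<⇒≱ R<j ∘ proj₂ ∘ proj₁ (clusteron j))
    }
  }

cluster-supported : ∀ {L R} → Cluster a L R → SupportedIn a L (suc ∣ L - R ∣)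
cluster-supported {L = L} {R} c j occ =
  proj₁ within , subst (j <_) (sym L+[1+R-L]≡R+1) (≤-<-trans (proj₂ within) (i<i+1 R))
  where
  open Cluster c
  within = occupied⇒within j occ
  L+[1+R-L]≡R+1 : L + + suc ∣ L - R ∣ ≡ R + 1ℤ
  L+[1+R-L]≡R+1 = trans (cong (λ d → L + (1ℤ + d)) (∣-∣-≤ (<⇒≤ L<R))) (cancel L R)
    where
    cancel : ∀ L R → L + (1ℤ + (R - L)) ≡ R + 1ℤ
    cancel = solve-∀

lemma5p6 : (C : State) → (L R : ℤ) → ClusteronOn C L R → L < R →
    ∃ λ D → Reachable C D × (FlatClusteron D ⊎ FlatNearClusteron D)
lemma5p6 C L R clusteron L<R =
  settle (suc (excessIn C L (suc ∣ L - R ∣))) (ℕ.n<1+n _) (cluster-supported cluster) (inj₁ (L , R , cluster))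
  where
  cluster : Cluster C L R
  cluster = clusteronOn⇒cluster clusteron L<R
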